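{- Let $\mathcal{F}$ be a class of $\{\pm1\}$-valued functions on Boolean cubes $\{\pm1\}^N$ (of varying $N$) such that for every $f\in\mathcal{F}$ and every $t\ge1$, the XOR (i.e., product of $\pm1$ values) of $t$ copies of $f$ on disjoint sets of variables also belongs to $\mathcal{F}$. Let $k\ge1$ and $b>0$, and suppose $L_{1,k}(f)\le b^k$ for every $f\in\mathcal{F}$. Then for every $f\in\mathcal{F}$, \[ L_{1,k}(f)\le 2e\cdot\frac{1-|\mathbb{E}[f]|}{2}\cdot b^k. \]
   Context: For $f\colon\{\pm1\}^N\to\{\pm1\}$ and $S\subseteq[N]$, $\hat f(S)=\mathbb{E}_x[f(x)\prod_{i\in S}x_i]$ for uniform $x$, $\mathbb{E}[f]$ is over uniform inputs, and $L_{1,k}(f)=\sum_{|S|=k}|\hat f(S)|$.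
   Formalization: The parameter $b$ ranges over the positive rationals. -}

module Defs where

open import Data.Nat as ℕ using (ℕ; zero; suc)
open import Data.Fin using (Fin; combine)
open import Data.Bool using (Bool; true; false; _xor_; if_then_else_)
open import Data.Vec using (Vec; []; _∷_; tabulate; foldr; zipWith; lookup)
open import Data.List using (List; []; _∷_; _++_; map; filter)
open import Data.Fin.Subset using (Subset) renaming (∣_∣ to card)
open import Data.Integer using (+_)
open import Data.Rational using (ℚ; 0ℚ; 1ℚ; _+_; _*_; -_; _-_; ∣_∣; _/_)

-- A point of the Boolean cube {±1}^N, encoded by bits: bit b stands for (-1)^b,
-- i.e. false ↦ +1, true ↦ -1.
Cube : ℕ → Set
Cube N = Vec Bool N

-- A {±1}-valued function on {±1}^N (output bit b stands for (-1)^b).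
BFun : ℕ → Set
BFun N = Cube N → Bool

sgn : Bool → ℚ
sgn false = 1ℚ
sgn true  = - 1ℚ

allCube : (N : ℕ) → List (Cube N)
allCube zero    = [] ∷ []
allCube (suc N) = map (false ∷_) (allCube N) ++ map (true ∷_) (allCube N)

sumℚ : List ℚ → ℚ
sumℚ []       = 0ℚ
sumℚ (q ∷ qs) = q + sumℚ qs

prodℚ : {n : ℕ} → Vec ℚ n → ℚ
prodℚ = foldr _ _*_ 1ℚ

powℚ : ℚ → ℕ → ℚ
powℚ q zero    = 1ℚ
powℚ q (suc n) = q * powℚ q n

half : ℚ
half = + 1 / 2

Expect : (N : ℕ) → (Cube N → ℚ) → ℚ
Expect N g = powℚ half N * sumℚ (map g (allCube N))

meanF : {N : ℕ} → BFun N → ℚ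
meanF {N} f = Expect N (λ x → sgn (f x))

chi : {N : ℕ} → Subset N → Cube N → ℚ
chi S x = prodℚ (zipWith (λ s b → if s then sgn b else 1ℚ) S x)

fourier : {N : ℕ} → BFun N → Subset N → ℚ
fourier {N} f S = Expect N (λ x → sgn (f x) * chi S x)

subsetsOfSize : (N k : ℕ) → List (Subset N)
subsetsOfSize N k = filter (λ S → card S ℕ.≟ k) (allCube N)

L1 : {N : ℕ} → ℕ → BFun N → ℚ
L1 k f = sumℚ (map (λ S → ∣ fourier f S ∣) (subsetsOfSize _ k))

xorCopies : {N : ℕ} (t : ℕ) → BFun N → BFun (t ℕ.* N)
xorCopies {N} t f x =
  foldr _ _xor_ false (tabulate {n = t} (λ j → f (tabulate (λ i → lookup x (combine j i)))))

Class : Set₁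
Class = (N : ℕ) → BFun N → Set

XorClosed : Class → Set
XorClosed 𝓕 = ∀ {N} (f : BFun N) → 𝓕 N f → (t : ℕ) → 1 ℕ.≤ t → 𝓕 (t ℕ.* N) (xorCopies t f)

-- eUpper m = (1 + 1/(m+1))^(m+2); a strictly decreasing sequence of rationals
-- converging to e.  "q ≤ c·e" (c ≥ 0) is expressed as "∀ m, q ≤ c·eUpper m".
eUpper : ℕ → ℚ
eUpper m = powℚ (1ℚ + (+ 1 / suc m)) (suc (suc m))

{-# OPTIONS --safe #-}
module Submission where

-- Write μ = |E f| and L = L_{1,k}(f). The Fourier coefficients of F ⊕ G on disjoint variables are
-- the products F̂(S) Ĝ(T), so for k ≥ 1 the level-k coefficients of F ⊕ G include F̂(S) Ĝ(∅) for
-- |S| = k and F̂(∅) Ĝ(T) for |T| = k, whence L_{1,k}(F ⊕ G) ≥ L_{1,k}(F) |E G| + |E F| L_{1,k}(G).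
-- Iterating along f^{⊕t} gives (t+1) μ^t L ≤ L_{1,k}(f^{⊕(t+1)}) ≤ b^k for every t. Choosing t
-- with 1/(t+2) < 1 - μ ≤ 1/(t+1), Bernoulli's inequality gives (t+1) μ^t (1 - μ) ≥ (1 + 1/(t+1))^{-(t+1)},
-- which is at least 1/e, so L ≤ e (1 - μ) b^k. As e is irrational it is replaced by its upper
-- approximations (1 + 1/(m+1))^{m+2}.

open import Defs
open import Data.Nat using (ℕ; zero; suc)
import Data.Nat as ℕ
import Data.Nat.Properties as ℕ
open import Data.Integer as ℤ using (+_; -[1+_])
import Data.Integer.Properties as ℤ
open import Data.Rational
open import Data.Rational.Properties
import Data.Rational.Unnormalised as ℚᵘ
import Data.Rational.Unnormalised.Properties as ℚᵘ
open import Data.Bool using (Bool; true; false; _xor_; if_then_else_)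
open import Data.Vec as Vec using (Vec; []; _∷_; _++_)
import Data.Vec.Properties as Vec
open import Data.List as List using (List; map; filter)
import Data.List.Properties as List
open import Data.Fin using (combine)
open import Data.Fin.Subset using (Subset; outside) renaming (∣_∣ to card; ⊥ to ∅)
open import Data.Product using (∃; _×_; _,_; proj₁; proj₂)
open import Data.Sum using (inj₁; inj₂)
open import Data.Empty using (⊥-elim)
open import Relation.Binary.PropositionalEquality
open import Relation.Nullary using (Dec; does; ¬_; yes; no)
open import Relation.Unary using (Decidable)
open import Data.Rational.Solver using (module +-*-Solver)
open import Data.Nat.Tactic.RingSolver using (solve-∀)
open import Algebra.Bundles using (CommutativeMonoid)
import Algebra.Properties.CommutativeSemigroup as CommSemigroupProperties

open +-*-Solver using (solve; _:+_; _:*_; _:-_; :-_; _:=_; con)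
module *-CS = CommSemigroupProperties (CommutativeMonoid.commutativeSemigroup *-1-commutativeMonoid)
module +-CS = CommSemigroupProperties (CommutativeMonoid.commutativeSemigroup +-0-commutativeMonoid)

0≤1 : 0ℚ ≤ 1ℚ
0≤1 = *≤* (ℤ.+≤+ ℕ.z≤n)

0<1 : 0ℚ < 1ℚ
0<1 = *<* (ℤ.+<+ (ℕ.s≤s ℕ.z≤n))

*-monoʳ-≤-0≤ : ∀ {r p q} → 0ℚ ≤ r → p ≤ q → p * r ≤ q * r
*-monoʳ-≤-0≤ {r} 0≤r = *-monoʳ-≤-nonNeg r {{nonNegative 0≤r}}

*-monoˡ-≤-0≤ : ∀ {r p q} → 0ℚ ≤ r → p ≤ q → r * p ≤ r * q
*-monoˡ-≤-0≤ {r} 0≤r = *-monoˡ-≤-nonNeg r {{nonNegative 0≤r}}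

*-cancelʳ-≤-0< : ∀ {r p q} → 0ℚ < r → p * r ≤ q * r → p ≤ q
*-cancelʳ-≤-0< {r} 0<r = *-cancelʳ-≤-pos r {{positive 0<r}}

*-cancelˡ-≤-0< : ∀ {r p q} → 0ℚ < r → r * p ≤ r * q → p ≤ q
*-cancelˡ-≤-0< {r} 0<r = *-cancelˡ-≤-pos r {{positive 0<r}}

0≤* : ∀ {p q} → 0ℚ ≤ p → 0ℚ ≤ q → 0ℚ ≤ p * q
0≤* {p} 0≤p 0≤q = ≤-trans (≤-reflexive (sym (*-zeroʳ p))) (*-monoˡ-≤-0≤ 0≤p 0≤q)

0<* : ∀ {p q} → 0ℚ < p → 0ℚ < q → 0ℚ < p * q
0<* {p} {q} 0<p 0<q = positive⁻¹ (p * q) {{pos*pos⇒pos p {{positive 0<p}} q {{positive 0<q}}}}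

0≤p*p : ∀ p → 0ℚ ≤ p * p
0≤p*p p with ≤-total 0ℚ p
... | inj₁ 0≤p = 0≤* 0≤p 0≤p
... | inj₂ p≤0 = subst (0ℚ ≤_) (square-neg p) (0≤* 0≤-p 0≤-p)
  where
  0≤-p : 0ℚ ≤ - p
  0≤-p = neg-antimono-≤ p≤0
  square-neg : ∀ p → - p * - p ≡ p * p
  square-neg = solve 1 (λ p → :- p :* :- p := p :* p) refl

p≤p+q : ∀ {p q} → 0ℚ ≤ q → p ≤ p + q
p≤p+q {p} 0≤q = ≤-trans (≤-reflexive (sym (+-identityʳ p))) (+-monoʳ-≤ p 0≤q)

0≤q-p : ∀ {p q} → p ≤ q → 0ℚ ≤ q - p
0≤q-p {p} p≤q = ≤-trans (≤-reflexive (sym (+-inverseʳ p))) (+-monoˡ-≤ (- p) p≤q)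

0≤powℚ : ∀ {p} n → 0ℚ ≤ p → 0ℚ ≤ powℚ p n
0≤powℚ zero    _   = 0≤1
0≤powℚ (suc n) 0≤p = 0≤* 0≤p (0≤powℚ n 0≤p)

0<powℚ : ∀ {p} n → 0ℚ < p → 0ℚ < powℚ p n
0<powℚ zero    _   = 0<1
0<powℚ (suc n) 0<p = 0<* 0<p (0<powℚ n 0<p)

powℚ-* : ∀ p q n → powℚ (p * q) n ≡ powℚ p n * powℚ q n
powℚ-* p q zero    = refl
powℚ-* p q (suc n) = trans (cong ((p * q) *_) (powℚ-* p q n)) (*-CS.interchange p q (powℚ p n) (powℚ q n))

powℚ-1 : ∀ n → powℚ 1ℚ n ≡ 1ℚ
powℚ-1 zero    = refl
powℚ-1 (suc n) = trans (*-identityˡ _) (powℚ-1 n)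

-- Unlike + n / 1, this unfolds definitionally, so ring identities in fromℕ n also cover fromℕ (suc n).
fromℕ : ℕ → ℚ
fromℕ zero    = 0ℚ
fromℕ (suc n) = 1ℚ + fromℕ n

0≤fromℕ : ∀ n → 0ℚ ≤ fromℕ n
0≤fromℕ zero    = ≤-refl
0≤fromℕ (suc n) = +-mono-≤ 0≤1 (0≤fromℕ n)

0<fromℕ-suc : ∀ n → 0ℚ < fromℕ (suc n)
0<fromℕ-suc n = <-≤-trans 0<1 (p≤p+q (0≤fromℕ n))

fromℕ-≤-suc : ∀ n → fromℕ n ≤ fromℕ (suc n)
fromℕ-≤-suc n = ≤-trans (≤-reflexive (sym (+-identityˡ (fromℕ n)))) (+-monoˡ-≤ (fromℕ n) 0≤1)

toℚᵘ-fromℕ : ∀ n → toℚᵘ (fromℕ n) ℚᵘ.≃ ℚᵘ.mkℚᵘ (+ n) 0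
toℚᵘ-fromℕ zero    = ℚᵘ.*≡* refl
toℚᵘ-fromℕ (suc n) = ℚᵘ.≃-trans (toℚᵘ-homo-+ 1ℚ (fromℕ n))
  (ℚᵘ.≃-trans (ℚᵘ.+-congʳ (toℚᵘ 1ℚ) (toℚᵘ-fromℕ n)) (ℚᵘ.*≡* (cross-multiplied n)))
  where
  cross-multiplied : ∀ n → (+ 1 ℤ.* + 1 ℤ.+ + n ℤ.* + 1) ℤ.* + 1 ≡ + suc n ℤ.* + 1
  cross-multiplied n rewrite ℤ.*-identityʳ (+ n) = refl

fromℕ-unbounded : ∀ p → ∃ λ n → p < fromℕ n
fromℕ-unbounded p@(mkℚ -[1+ _ ] _ _) = 0 , negative⁻¹ p
fromℕ-unbounded (mkℚ (+ a) d _) =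
  suc a , toℚᵘ-cancel-< (ℚᵘ.<-respʳ-≃ (ℚᵘ.≃-sym (toℚᵘ-fromℕ (suc a))) (ℚᵘ.*<* a<[1+a][1+d]))
  where
  a<[1+a][1+d] : + a ℤ.* + 1 ℤ.< + suc a ℤ.* + suc d
  a<[1+a][1+d] rewrite ℤ.*-identityʳ (+ a) | sym (ℤ.pos-* (suc a) (suc d)) =
    ℤ.+<+ (ℕ.≤-trans (ℕ.n<1+n a) (ℕ.m≤m*n (suc a) (suc d)))

archimedean : ∀ {x} → 0ℚ < x → ∀ y → ∃ λ n → y < fromℕ (suc n) * x
archimedean {x} 0<x y = let n , y/x<n = fromℕ-unbounded (y * 1/ x) in n , (begin-strict
    y                 ≡⟨ y≡y/x*x ⟩
    y * 1/ x * x      <⟨ *-monoˡ-<-pos x {{positive 0<x}} y/x<n ⟩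
    fromℕ n * x       ≤⟨ *-monoʳ-≤-0≤ (<⇒≤ 0<x) (fromℕ-≤-suc n) ⟩
    fromℕ (suc n) * x ∎)
  where
  open ≤-Reasoning
  instance _ = >-nonZero 0<x
  y≡y/x*x : y ≡ y * 1/ x * x
  y≡y/x*x = sym (trans (*-assoc y (1/ x) x) (trans (cong (y *_) (*-inverseˡ x)) (*-identityʳ y)))

-- Bernoulli's inequality (1 + c/d)^n ≥ 1 + n c/d, cleared of denominators.
bernoulli : ∀ {d c} n → 0ℚ ≤ d → 0ℚ ≤ d + c →
            powℚ d n * (d + fromℕ n * c) ≤ d * powℚ (d + c) n
bernoulli {d} {c} zero    _   _     = ≤-reflexive (trivial d c)
  where
  trivial : ∀ d c → 1ℚ * (d + 0ℚ * c) ≡ d * 1ℚ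
  trivial = solve 2 (λ d c → con 1ℚ :* (d :+ con 0ℚ :* c) := d :* con 1ℚ) refl
bernoulli {d} {c} (suc n) 0≤d 0≤d+c = begin
    d * D * (d + (1ℚ + fromℕ n) * c)
  ≤⟨ p≤p+q (0≤* (0≤* (0≤fromℕ n) (0≤p*p c)) (0≤powℚ n 0≤d)) ⟩
    d * D * (d + (1ℚ + fromℕ n) * c) + fromℕ n * (c * c) * D
  ≡⟨ expand d c (fromℕ n) D ⟩
    (d + c) * (D * (d + fromℕ n * c))
  ≤⟨ *-monoˡ-≤-0≤ 0≤d+c (bernoulli n 0≤d 0≤d+c) ⟩
    (d + c) * (d * powℚ (d + c) n)
  ≡⟨ *-CS.x∙yz≈y∙xz (d + c) d (powℚ (d + c) n) ⟩
    d * ((d + c) * powℚ (d + c) n)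
  ∎
  where
  open ≤-Reasoning
  D = powℚ d n
  expand : ∀ d c n D → d * D * (d + (1ℚ + n) * c) + n * (c * c) * D ≡ (d + c) * (D * (d + n * c))
  expand = solve 4 (λ d c n D → d :* D :* (d :+ (con 1ℚ :+ n) :* c) :+ n :* (c :* c) :* D := (d :+ c) :* (D :* (d :+ n :* c))) refl

eBase : ℕ → ℚ
eBase n = 1ℚ + + 1 / suc n

-- (1 + 1/(n+1))^(n+1) increases to e, while eUpper n = (1 + 1/(n+1))^(n+2) decreases to it.
eLower : ℕ → ℚ
eLower n = powℚ (eBase n) (suc n)

1/[1+n]*[1+n]≡1 : ∀ n → + 1 / suc n * fromℕ (suc n) ≡ 1ℚ
1/[1+n]*[1+n]≡1 n = toℚᵘ-injective (ℚᵘ.≃-trans (toℚᵘ-homo-* (+ 1 / suc n) (fromℕ (suc n)))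
  (ℚᵘ.≃-trans (ℚᵘ.*-cong (toℚᵘ-fromℚᵘ (ℚᵘ.mkℚᵘ (+ 1) n)) (toℚᵘ-fromℕ (suc n)))
              (ℚᵘ.*≡* (cong (λ m → + suc m) (cross-multiplied n)))))
  where
  cross-multiplied : ∀ n → (n ℕ.+ 0 ℕ.* suc n) ℕ.* 1 ≡ n ℕ.* 1 ℕ.+ 0 ℕ.* suc (n ℕ.* 1)
  cross-multiplied = solve-∀

eBase-*-fromℕ : ∀ n → eBase n * fromℕ (suc n) ≡ fromℕ (suc (suc n))
eBase-*-fromℕ n = begin
  (1ℚ + r) * a    ≡⟨ *-distribʳ-+ a 1ℚ r ⟩
  1ℚ * a + r * a  ≡⟨ cong₂ _+_ (*-identityˡ a) (1/[1+n]*[1+n]≡1 n) ⟩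
  a + 1ℚ          ≡⟨ +-comm a 1ℚ ⟩
  1ℚ + a          ∎
  where
  open ≡-Reasoning
  r = + 1 / suc n
  a = fromℕ (suc n)

powℚ-fromℕ-suc-suc : ∀ n k → powℚ (fromℕ (suc (suc n))) k ≡ powℚ (eBase n) k * powℚ (fromℕ (suc n)) k
powℚ-fromℕ-suc-suc n k = trans (cong (λ x → powℚ x k) (sym (eBase-*-fromℕ n))) (powℚ-* (eBase n) (fromℕ (suc n)) k)

1≤eBase : ∀ n → 1ℚ ≤ eBase n
1≤eBase n = p≤p+q (nonNegative⁻¹ (+ 1 / suc n) {{normalize-nonNeg 1 (suc n)}})

0≤eLower : ∀ n → 0ℚ ≤ eLower n
0≤eLower n = 0≤powℚ (suc n) (≤-trans 0≤1 (1≤eBase n))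

0≤eUpper : ∀ n → 0ℚ ≤ eUpper n
0≤eUpper n = 0≤powℚ (suc (suc n)) (≤-trans 0≤1 (1≤eBase n))

eLower≤eUpper-same : ∀ n → eLower n ≤ eUpper n
eLower≤eUpper-same n = begin
  eLower n           ≡⟨ sym (*-identityˡ (eLower n)) ⟩
  1ℚ * eLower n      ≤⟨ *-monoʳ-≤-0≤ (0≤eLower n) (1≤eBase n) ⟩
  eBase n * eLower n ∎
  where open ≤-Reasoning

-- Cleared of denominators, the two monotonicity steps are Bernoulli's inequality
-- with d = (n+2)², c = -1, respectively d = (n+1)(n+3), c = 1.
eLower-≤-suc : ∀ n → eLower n ≤ eLower (suc n)
eLower-≤-suc n = *-cancelʳ-≤-0< 0<A*bB (begin
    P * (A * bB)  ≡⟨ sym (*-assoc P A bB) ⟩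
    P * A * bB    ≡⟨ cong (_* bB) (sym (powℚ-fromℕ-suc-suc n (suc n))) ⟩
    B * bB        ≤⟨ cross ⟩
    A * C         ≡⟨ cong (A *_) (powℚ-fromℕ-suc-suc (suc n) (suc (suc n))) ⟩
    A * (Q * bB)  ≡⟨ *-CS.x∙yz≈y∙xz A Q bB ⟩
    Q * (A * bB)  ∎)
  where
  open ≤-Reasoning
  a = fromℕ (suc n)
  b = fromℕ (suc (suc n))
  c = fromℕ (suc (suc (suc n)))
  A = powℚ a (suc n)
  B = powℚ b (suc n)
  bB = powℚ b (suc (suc n))
  C = powℚ c (suc (suc n))
  P = eLower n
  Q = eLower (suc n)
  0<A*bB : 0ℚ < A * bB
  0<A*bB = 0<* (0<powℚ (suc n) (0<fromℕ-suc n)) (0<powℚ (suc (suc n)) (0<fromℕ-suc (suc n)))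
  b*b-b≡a*b : ∀ a → let b = 1ℚ + a in b * b + b * - 1ℚ ≡ a * b
  b*b-b≡a*b = solve 1 (λ a → let b = con 1ℚ :+ a in b :* b :+ b :* :- con 1ℚ := a :* b) refl
  b*b-1≡a*c : ∀ a → let b = 1ℚ + a; c = 1ℚ + b in b * b + - 1ℚ ≡ a * c
  b*b-1≡a*c = solve 1 (λ a → let b = con 1ℚ :+ a; c = con 1ℚ :+ b in b :* b :+ :- con 1ℚ := a :* c) refl
  regroupˡ : ∀ a b B → a * b * b * (B * (b * B)) ≡ b * B * (b * B) * (a * b)
  regroupˡ = solve 3 (λ a b B → a :* b :* b :* (B :* (b :* B)) := b :* B :* (b :* B) :* (a :* b)) refl
  regroupʳ : ∀ a b A C → b * b * (a * A * C) ≡ a * b * b * (A * C)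
  regroupʳ = solve 4 (λ a b A C → b :* b :* (a :* A :* C) := a :* b :* b :* (A :* C)) refl
  cross : B * bB ≤ A * C
  cross = *-cancelˡ-≤-0< (0<* (0<* (0<fromℕ-suc n) (0<fromℕ-suc (suc n))) (0<fromℕ-suc (suc n))) (begin
      a * b * b * (B * bB)
    ≡⟨ regroupˡ a b B ⟩
      bB * bB * (a * b)
    ≡⟨ cong₂ _*_ (sym (powℚ-* b b (suc (suc n)))) (sym (b*b-b≡a*b a)) ⟩
      powℚ (b * b) (suc (suc n)) * (b * b + b * - 1ℚ)
    ≤⟨ bernoulli (suc (suc n)) (0≤p*p b)
         (subst (0ℚ ≤_) (sym (b*b-1≡a*c a)) (0≤* (0≤fromℕ (suc n)) (0≤fromℕ (suc (suc (suc n)))))) ⟩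
      b * b * powℚ (b * b + - 1ℚ) (suc (suc n))
    ≡⟨ cong (λ x → b * b * powℚ x (suc (suc n))) (b*b-1≡a*c a) ⟩
      b * b * powℚ (a * c) (suc (suc n))
    ≡⟨ cong (b * b *_) (powℚ-* a c (suc (suc n))) ⟩
      b * b * (a * A * C)
    ≡⟨ regroupʳ a b A C ⟩
      a * b * b * (A * C)
    ∎)

eUpper-suc-≤ : ∀ n → eUpper (suc n) ≤ eUpper n
eUpper-suc-≤ n = *-cancelʳ-≤-0< 0<A₂*B₃ (begin
    Q * (A₂ * B₃)  ≡⟨ *-CS.x∙yz≈y∙xz Q A₂ B₃ ⟩
    A₂ * (Q * B₃)  ≡⟨ cong (A₂ *_) (sym (powℚ-fromℕ-suc-suc (suc n) (suc (suc (suc n))))) ⟩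
    A₂ * C₃        ≤⟨ cross ⟩
    B₂ * B₃        ≡⟨ cong (_* B₃) (powℚ-fromℕ-suc-suc n (suc (suc n))) ⟩
    P * A₂ * B₃    ≡⟨ *-assoc P A₂ B₃ ⟩
    P * (A₂ * B₃)  ∎)
  where
  open ≤-Reasoning
  a = fromℕ (suc n)
  b = fromℕ (suc (suc n))
  c = fromℕ (suc (suc (suc n)))
  A₂ = powℚ a (suc (suc n))
  B₂ = powℚ b (suc (suc n))
  B₃ = powℚ b (suc (suc (suc n)))
  C₂ = powℚ c (suc (suc n))
  C₃ = powℚ c (suc (suc (suc n)))
  P = eUpper n
  Q = eUpper (suc n)
  0<a*c : 0ℚ < a * c
  0<a*c = 0<* (0<fromℕ-suc n) (0<fromℕ-suc (suc (suc n)))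
  0<A₂*B₃ : 0ℚ < A₂ * B₃
  0<A₂*B₃ = 0<* (0<powℚ (suc (suc n)) (0<fromℕ-suc n)) (0<powℚ (suc (suc (suc n))) (0<fromℕ-suc (suc n)))
  a*c+1≡b*b : ∀ a → let b = 1ℚ + a; c = 1ℚ + b in a * c + 1ℚ ≡ b * b
  a*c+1≡b*b = solve 1 (λ a → let b = con 1ℚ :+ a; c = con 1ℚ :+ b in a :* c :+ con 1ℚ := b :* b) refl
  a*c*c+1≡b*[a*c+b] : ∀ a → let b = 1ℚ + a; c = 1ℚ + b in a * c * c + 1ℚ ≡ b * (a * c + b * 1ℚ)
  a*c*c+1≡b*[a*c+b] = solve 1 (λ a → let b = con 1ℚ :+ a; c = con 1ℚ :+ b in a :* c :* c :+ con 1ℚ := b :* (a :* c :+ b :* con 1ℚ)) refl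
  regroupˡ : ∀ a c A₂ C₂ → a * c * (A₂ * (c * C₂)) ≡ A₂ * C₂ * (a * c * c)
  regroupˡ = solve 4 (λ a c A₂ C₂ → a :* c :* (A₂ :* (c :* C₂)) := A₂ :* C₂ :* (a :* c :* c)) refl
  regroupʳ : ∀ a c b B₂ → b * (a * c * (B₂ * B₂)) ≡ a * c * (B₂ * (b * B₂))
  regroupʳ = solve 4 (λ a c b B₂ → b :* (a :* c :* (B₂ :* B₂)) := a :* c :* (B₂ :* (b :* B₂))) refl
  cross : A₂ * C₃ ≤ B₂ * B₃
  cross = *-cancelˡ-≤-0< 0<a*c (begin
      a * c * (A₂ * C₃)
    ≡⟨ regroupˡ a c A₂ C₂ ⟩
      A₂ * C₂ * (a * c * c)
    ≤⟨ *-monoˡ-≤-0≤ (0≤* (0≤powℚ (suc (suc n)) (0≤fromℕ (suc n))) (0≤powℚ (suc (suc n)) (0≤fromℕ (suc (suc (suc n))))))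
         (≤-trans (p≤p+q 0≤1) (≤-reflexive (a*c*c+1≡b*[a*c+b] a))) ⟩
      A₂ * C₂ * (b * (a * c + b * 1ℚ))
    ≡⟨ *-CS.x∙yz≈y∙xz (A₂ * C₂) b (a * c + b * 1ℚ) ⟩
      b * (A₂ * C₂ * (a * c + b * 1ℚ))
    ≡⟨ cong (λ x → b * (x * (a * c + b * 1ℚ))) (sym (powℚ-* a c (suc (suc n)))) ⟩
      b * (powℚ (a * c) (suc (suc n)) * (a * c + b * 1ℚ))
    ≤⟨ *-monoˡ-≤-0≤ (0≤fromℕ (suc (suc n)))
         (bernoulli (suc (suc n)) (<⇒≤ 0<a*c) (≤-trans (<⇒≤ 0<a*c) (p≤p+q 0≤1))) ⟩
      b * (a * c * powℚ (a * c + 1ℚ) (suc (suc n)))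
    ≡⟨ cong (λ x → b * (a * c * powℚ x (suc (suc n)))) (a*c+1≡b*b a) ⟩
      b * (a * c * powℚ (b * b) (suc (suc n)))
    ≡⟨ cong (λ x → b * (a * c * x)) (powℚ-* b b (suc (suc n))) ⟩
      b * (a * c * (B₂ * B₂))
    ≡⟨ regroupʳ a c b B₂ ⟩
      a * c * (B₂ * B₃)
    ∎)

≤-suc⇒monotone : ∀ {f : ℕ → ℚ} → (∀ n → f n ≤ f (suc n)) → ∀ {m n} → m ℕ.≤′ n → f m ≤ f n
≤-suc⇒monotone step ℕ.≤′-refl         = ≤-refl
≤-suc⇒monotone step (ℕ.≤′-step m≤′n) = ≤-trans (≤-suc⇒monotone step m≤′n) (step _)

≥-suc⇒antitone : ∀ {f : ℕ → ℚ} → (∀ n → f (suc n) ≤ f n) → ∀ {m n} → m ℕ.≤′ n → f n ≤ f m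
≥-suc⇒antitone step ℕ.≤′-refl         = ≤-refl
≥-suc⇒antitone step (ℕ.≤′-step m≤′n) = ≤-trans (step _) (≥-suc⇒antitone step m≤′n)

eLower≤eUpper : ∀ n m → eLower n ≤ eUpper m
eLower≤eUpper n m = begin
  eLower n          ≤⟨ ≤-suc⇒monotone eLower-≤-suc (ℕ.≤⇒≤′ (ℕ.m≤m⊔n n m)) ⟩
  eLower (n ℕ.⊔ m)  ≤⟨ eLower≤eUpper-same (n ℕ.⊔ m) ⟩
  eUpper (n ℕ.⊔ m)  ≤⟨ ≥-suc⇒antitone eUpper-suc-≤ (ℕ.≤⇒≤′ (ℕ.m≤n⊔m n m)) ⟩
  eUpper m          ∎
  where open ≤-Reasoning

[1+t]^[1+t]≤[1+w][1+t][1+t-w]^t : ∀ t {w} → 0ℚ ≤ w → fromℕ t * w ≤ 1ℚ → 0ℚ ≤ fromℕ (suc t) + - w →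
  powℚ (fromℕ (suc t)) (suc t) ≤ (1ℚ + w) * (fromℕ (suc t) * powℚ (fromℕ (suc t) + - w) t)
[1+t]^[1+t]≤[1+w][1+t][1+t-w]^t t {w} 0≤w tw≤1 0≤a-w = begin
    a * Aₜ
  ≤⟨ p≤p+q (0≤* (0≤powℚ t (0≤fromℕ (suc t))) (0≤* 0≤w (0≤q-p tw≤1))) ⟩
    a * Aₜ + Aₜ * (w * (1ℚ - fromℕ t * w))
  ≡⟨ factor (fromℕ t) w Aₜ ⟩
    (1ℚ + w) * (Aₜ * (a + fromℕ t * - w))
  ≤⟨ *-monoˡ-≤-0≤ (+-mono-≤ 0≤1 0≤w) (bernoulli t (0≤fromℕ (suc t)) 0≤a-w) ⟩
    (1ℚ + w) * (a * powℚ (a + - w) t)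
  ∎
  where
  open ≤-Reasoning
  a = fromℕ (suc t)
  Aₜ = powℚ a t
  factor : ∀ x w A → let a = 1ℚ + x in a * A + A * (w * (1ℚ - x * w)) ≡ (1ℚ + w) * (A * (a + x * - w))
  factor = solve 3 (λ x w A → let a = con 1ℚ :+ x in a :* A :+ A :* (w :* (con 1ℚ :- x :* w)) := (con 1ℚ :+ w) :* (A :* (a :+ x :* :- w))) refl

-- With 1 - μ = (1 + w)/(t+2), the hypotheses give 0 ≤ w ≤ 1/(t+1) and t+1-w = (t+2) μ.
1≤eLower*[1+t][1-μ]μ^t : ∀ t μ → 0ℚ ≤ μ →
  fromℕ (suc t) * (1ℚ - μ) ≤ 1ℚ → 1ℚ < fromℕ (suc (suc t)) * (1ℚ - μ) →
  1ℚ ≤ eLower t * (fromℕ (suc t) * (1ℚ - μ) * powℚ μ t)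
1≤eLower*[1+t][1-μ]μ^t t μ 0≤μ aδ≤1 1<bδ = *-cancelˡ-≤-0< (0<powℚ (suc t) (0<fromℕ-suc t)) (begin
    powℚ a (suc t) * 1ℚ
  ≡⟨ *-identityʳ (powℚ a (suc t)) ⟩
    powℚ a (suc t)
  ≤⟨ [1+t]^[1+t]≤[1+w][1+t][1+t-w]^t t 0≤w tw≤1 (subst (0ℚ ≤_) (sym a-w≡bμ) (0≤* (0≤fromℕ (suc (suc t))) 0≤μ)) ⟩
    (1ℚ + w) * (a * powℚ (a + - w) t)
  ≡⟨ cong (λ x → (1ℚ + w) * (a * x)) (trans (cong (λ x → powℚ x t) a-w≡bμ) (powℚ-* b μ t)) ⟩
    (1ℚ + w) * (a * (Bₜ * Mₜ))
  ≡⟨ regroup b μ a Bₜ Mₜ ⟩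
    b * Bₜ * X
  ≡⟨ cong (_* X) (powℚ-fromℕ-suc-suc t (suc t)) ⟩
    eLower t * powℚ a (suc t) * X
  ≡⟨ *-CS.xy∙z≈y∙xz (eLower t) (powℚ a (suc t)) X ⟩
    powℚ a (suc t) * (eLower t * X)
  ∎)
  where
  open ≤-Reasoning
  a = fromℕ (suc t)
  b = fromℕ (suc (suc t))
  w = b * (1ℚ - μ) - 1ℚ
  Bₜ = powℚ b t
  Mₜ = powℚ μ t
  X = a * (1ℚ - μ) * Mₜ
  0≤w : 0ℚ ≤ w
  0≤w = 0≤q-p (<⇒≤ 1<bδ)
  a*w≡b*aδ-a : ∀ a μ → let b = 1ℚ + a in a * (b * (1ℚ - μ) - 1ℚ) ≡ b * (a * (1ℚ - μ)) - a
  a*w≡b*aδ-a = solve 2 (λ a μ → let b = con 1ℚ :+ a in a :* (b :* (con 1ℚ :- μ) :- con 1ℚ) := b :* (a :* (con 1ℚ :- μ)) :- a) refl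
  b-a≡1 : ∀ a → (1ℚ + a) * 1ℚ - a ≡ 1ℚ
  b-a≡1 = solve 1 (λ a → (con 1ℚ :+ a) :* con 1ℚ :- a := con 1ℚ) refl
  tw≤1 : fromℕ t * w ≤ 1ℚ
  tw≤1 = begin
    fromℕ t * w              ≤⟨ *-monoʳ-≤-0≤ 0≤w (fromℕ-≤-suc t) ⟩
    a * w                    ≡⟨ a*w≡b*aδ-a a μ ⟩
    b * (a * (1ℚ - μ)) - a   ≤⟨ +-monoˡ-≤ (- a) (*-monoˡ-≤-0≤ (0≤fromℕ (suc (suc t))) aδ≤1) ⟩
    b * 1ℚ - a               ≡⟨ b-a≡1 a ⟩
    1ℚ                       ∎
  a-w≡bμ′ : ∀ a μ → let b = 1ℚ + a in a + - (b * (1ℚ - μ) - 1ℚ) ≡ b * μ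
  a-w≡bμ′ = solve 2 (λ a μ → let b = con 1ℚ :+ a in a :+ :- (b :* (con 1ℚ :- μ) :- con 1ℚ) := b :* μ) refl
  a-w≡bμ : a + - w ≡ b * μ
  a-w≡bμ = a-w≡bμ′ a μ
  regroup : ∀ b μ a B M → (1ℚ + (b * (1ℚ - μ) - 1ℚ)) * (a * (B * M)) ≡ b * B * (a * (1ℚ - μ) * M)
  regroup = solve 5 (λ b μ a B M → (con 1ℚ :+ (b :* (con 1ℚ :- μ) :- con 1ℚ)) :* (a :* (B :* M)) := b :* B :* (a :* (con 1ℚ :- μ) :* M)) refl

crossing : ∀ {P : ℕ → Set} → Decidable P → ¬ P 0 → ∀ {n} → P n → ∃ λ t → ¬ P t × P (suc t)
crossing P? ¬P₀ {zero}  P₀   = ⊥-elim (¬P₀ P₀)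
crossing P? ¬P₀ {suc n} Pₙ₊₁ with P? n
... | yes Pₙ = crossing P? ¬P₀ Pₙ
... | no ¬Pₙ = n , ¬Pₙ , Pₙ₊₁

bounded-multiples⇒≤0 : ∀ {L B} → (∀ t → fromℕ (suc t) * L ≤ B) → L ≤ 0ℚ
bounded-multiples⇒≤0 {L} {B} bounded with L ≤? 0ℚ
... | yes L≤0 = L≤0
... | no  L≰0 = let t , B<[t+1]L = archimedean (≰⇒> L≰0) B in
  ⊥-elim (<-irrefl refl (<-≤-trans B<[t+1]L (bounded t)))

-- For μ < 1 the hypothesis is used at the t with 1/(t+2) < 1 - μ ≤ 1/(t+1); for μ = 1 it forces L ≤ 0.
≤eUpper*[1-μ]*B : ∀ {μ L B} → 0ℚ ≤ μ → μ ≤ 1ℚ → 0ℚ ≤ L →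
  (∀ t → fromℕ (suc t) * powℚ μ t * L ≤ B) → ∀ m → L ≤ eUpper m * (1ℚ - μ) * B
≤eUpper*[1-μ]*B {μ} {L} {B} 0≤μ μ≤1 0≤L growth m with μ <? 1ℚ
... | no μ≮1 = begin
    L                         ≤⟨ bounded-multiples⇒≤0 bounded ⟩
    0ℚ                        ≡⟨ sym (vanish (eUpper m) B) ⟩
    eUpper m * (1ℚ - 1ℚ) * B  ≡⟨ cong (λ x → eUpper m * (1ℚ - x) * B) (sym μ≡1) ⟩
    eUpper m * (1ℚ - μ) * B   ∎
  where
  open ≤-Reasoning
  μ≡1 : μ ≡ 1ℚ
  μ≡1 = ≤-antisym μ≤1 (≮⇒≥ μ≮1)
  vanish : ∀ e B → e * (1ℚ - 1ℚ) * B ≡ 0ℚ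
  vanish = solve 2 (λ e B → e :* (con 1ℚ :- con 1ℚ) :* B := con 0ℚ) refl
  bounded : ∀ t → fromℕ (suc t) * L ≤ B
  bounded t = begin
    fromℕ (suc t) * L                  ≡⟨ cong (_* L) (sym (*-identityʳ (fromℕ (suc t)))) ⟩
    fromℕ (suc t) * 1ℚ * L             ≡⟨ cong (λ x → fromℕ (suc t) * x * L) (sym (trans (cong (λ x → powℚ x t) μ≡1) (powℚ-1 t))) ⟩
    fromℕ (suc t) * powℚ μ t * L       ≤⟨ growth t ⟩
    B                                  ∎
... | yes μ<1 = begin
    L                        ≡⟨ sym (*-identityˡ L) ⟩
    1ℚ * L                   ≤⟨ *-monoʳ-≤-0≤ 0≤L (1≤eLower*[1+t][1-μ]μ^t t μ 0≤μ (≮⇒≥ ¬Pₜ) Pₜ₊₁) ⟩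
    eLower t * X * L         ≤⟨ *-monoʳ-≤-0≤ 0≤L (*-monoʳ-≤-0≤ 0≤X (eLower≤eUpper t m)) ⟩
    eUpper m * X * L         ≡⟨ regroup (eUpper m) (fromℕ (suc t)) δ (powℚ μ t) L ⟩
    eUpper m * δ * (fromℕ (suc t) * powℚ μ t * L)
                             ≤⟨ *-monoˡ-≤-0≤ (0≤* (0≤eUpper m) (<⇒≤ 0<δ)) (growth t) ⟩
    eUpper m * δ * B         ∎
  where
  open ≤-Reasoning
  δ = 1ℚ - μ
  0<δ : 0ℚ < δ
  0<δ = <-respˡ-≡ (+-inverseʳ μ) (+-monoˡ-< (- μ) μ<1)
  P : ℕ → Set
  P t = 1ℚ < fromℕ (suc t) * δ
  ¬P₀ : ¬ P 0
  ¬P₀ 1<δ = <-irrefl refl (<-≤-trans 1<δ (≤-trans (≤-reflexive (*-identityˡ′ δ)) (p-q≤p 0≤μ)))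
    where
    *-identityˡ′ : ∀ p → (1ℚ + 0ℚ) * p ≡ p
    *-identityˡ′ = solve 1 (λ p → (con 1ℚ :+ con 0ℚ) :* p := p) refl
    p-q≤p : ∀ {p q} → 0ℚ ≤ q → p - q ≤ p
    p-q≤p {p} {q} 0≤q = ≤-trans (+-monoʳ-≤ p (neg-antimono-≤ 0≤q)) (≤-reflexive (+-identityʳ p))
  crossing-point : ∃ λ t → ¬ P t × P (suc t)
  crossing-point = let T , 1<[T+1]δ = archimedean 0<δ 1ℚ in crossing (λ t → 1ℚ <? fromℕ (suc t) * δ) ¬P₀ {T} 1<[T+1]δ
  t = proj₁ crossing-point
  ¬Pₜ = proj₁ (proj₂ crossing-point)
  Pₜ₊₁ = proj₂ (proj₂ crossing-point)
  X = fromℕ (suc t) * δ * powℚ μ t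
  0≤X : 0ℚ ≤ X
  0≤X = 0≤* (0≤* (0≤fromℕ (suc t)) (<⇒≤ 0<δ)) (0≤powℚ t 0≤μ)
  regroup : ∀ e a δ M L → e * (a * δ * M) * L ≡ e * δ * (a * M * L)
  regroup = solve 5 (λ e a δ M L → e :* (a :* δ :* M) :* L := e :* δ :* (a :* M :* L)) refl

recurrence-lower-bound : ∀ {μ L} {g : ℕ → ℚ} → 0ℚ ≤ μ → 0ℚ ≤ g 0 →
  (∀ t → L * powℚ μ t + μ * g t ≤ g (suc t)) → ∀ t → fromℕ (suc t) * powℚ μ t * L ≤ g (suc t)
recurrence-lower-bound {μ} {L} {g} 0≤μ 0≤g₀ step zero = begin
  (1ℚ + 0ℚ) * 1ℚ * L      ≡⟨ unit L ⟩
  L * 1ℚ                  ≤⟨ p≤p+q (0≤* 0≤μ 0≤g₀) ⟩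
  L * 1ℚ + μ * g 0        ≤⟨ step 0 ⟩
  g 1                     ∎
  where
  open ≤-Reasoning
  unit : ∀ L → (1ℚ + 0ℚ) * 1ℚ * L ≡ L * 1ℚ
  unit = solve 1 (λ L → (con 1ℚ :+ con 0ℚ) :* con 1ℚ :* L := L :* con 1ℚ) refl
recurrence-lower-bound {μ} {L} {g} 0≤μ 0≤g₀ step (suc t) = begin
    (1ℚ + fromℕ (suc t)) * (μ * powℚ μ t) * L
  ≡⟨ expand (fromℕ (suc t)) μ (powℚ μ t) L ⟩
    L * (μ * powℚ μ t) + μ * (fromℕ (suc t) * powℚ μ t * L)
  ≤⟨ +-monoʳ-≤ (L * (μ * powℚ μ t)) (*-monoˡ-≤-0≤ 0≤μ (recurrence-lower-bound 0≤μ 0≤g₀ step t)) ⟩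
    L * (μ * powℚ μ t) + μ * g (suc t)
  ≤⟨ step (suc t) ⟩
    g (suc (suc t))
  ∎
  where
  open ≤-Reasoning
  expand : ∀ n μ M L → (1ℚ + n) * (μ * M) * L ≡ L * (μ * M) + μ * (n * M * L)
  expand = solve 4 (λ n μ M L → (con 1ℚ :+ n) :* (μ :* M) :* L := L :* (μ :* M) :+ μ :* (n :* M :* L)) refl

sumℚ-++ : ∀ (ps qs : List ℚ) → sumℚ (ps List.++ qs) ≡ sumℚ ps + sumℚ qs
sumℚ-++ List.[]       qs = sym (+-identityˡ (sumℚ qs))
sumℚ-++ (p List.∷ ps) qs = trans (cong (_+_ p) (sumℚ-++ ps qs)) (sym (+-assoc p (sumℚ ps) (sumℚ qs)))

module _ {A : Set} where

  sumℚ-map-cong : ∀ {f g : A → ℚ} (xs : List A) → (∀ x → f x ≡ g x) → sumℚ (map f xs) ≡ sumℚ (map g xs)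
  sumℚ-map-cong List.[]       f≗g = refl
  sumℚ-map-cong (x List.∷ xs) f≗g = cong₂ _+_ (f≗g x) (sumℚ-map-cong xs f≗g)

  sumℚ-map-mono : ∀ {f g : A → ℚ} (xs : List A) → (∀ x → f x ≤ g x) → sumℚ (map f xs) ≤ sumℚ (map g xs)
  sumℚ-map-mono List.[]       f≤g = ≤-refl
  sumℚ-map-mono (x List.∷ xs) f≤g = +-mono-≤ (f≤g x) (sumℚ-map-mono xs f≤g)

  sumℚ-map-+ : ∀ (f g : A → ℚ) xs → sumℚ (map (λ x → f x + g x) xs) ≡ sumℚ (map f xs) + sumℚ (map g xs)
  sumℚ-map-+ f g List.[]       = refl
  sumℚ-map-+ f g (x List.∷ xs) = trans (cong (_+_ (f x + g x)) (sumℚ-map-+ f g xs))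
                                       (+-CS.interchange (f x) (g x) (sumℚ (map f xs)) (sumℚ (map g xs)))

  sumℚ-map-*ˡ : ∀ c (f : A → ℚ) xs → sumℚ (map (λ x → c * f x) xs) ≡ c * sumℚ (map f xs)
  sumℚ-map-*ˡ c f List.[]       = sym (*-zeroʳ c)
  sumℚ-map-*ˡ c f (x List.∷ xs) = trans (cong (_+_ (c * f x)) (sumℚ-map-*ˡ c f xs))
                                        (sym (*-distribˡ-+ c (f x) (sumℚ (map f xs))))

  sumℚ-map-0 : ∀ (xs : List A) → sumℚ (map (λ _ → 0ℚ) xs) ≡ 0ℚ
  sumℚ-map-0 List.[]       = refl
  sumℚ-map-0 (x List.∷ xs) = trans (+-identityˡ _) (sumℚ-map-0 xs)

  sumℚ-map-filter : ∀ {P : A → Set} (P? : ∀ x → Dec (P x)) (f : A → ℚ) xs →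
    sumℚ (map f (filter P? xs)) ≡ sumℚ (map (λ x → if does (P? x) then f x else 0ℚ) xs)
  sumℚ-map-filter P? f List.[]       = refl
  sumℚ-map-filter P? f (x List.∷ xs) with does (P? x)
  ... | true  = cong (_+_ (f x)) (sumℚ-map-filter P? f xs)
  ... | false = trans (sumℚ-map-filter P? f xs) (sym (+-identityˡ _))

cubeSum : (N : ℕ) → (Cube N → ℚ) → ℚ
cubeSum N g = sumℚ (map g (allCube N))

cubeSum-cong : ∀ N {f g : Cube N → ℚ} → (∀ x → f x ≡ g x) → cubeSum N f ≡ cubeSum N g
cubeSum-cong N = sumℚ-map-cong (allCube N)

cubeSum-mono : ∀ N {f g : Cube N → ℚ} → (∀ x → f x ≤ g x) → cubeSum N f ≤ cubeSum N g
cubeSum-mono N = sumℚ-map-mono (allCube N)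

cubeSum-+ : ∀ N (f g : Cube N → ℚ) → cubeSum N (λ x → f x + g x) ≡ cubeSum N f + cubeSum N g
cubeSum-+ N f g = sumℚ-map-+ f g (allCube N)

cubeSum-*ˡ : ∀ N c (f : Cube N → ℚ) → cubeSum N (λ x → c * f x) ≡ c * cubeSum N f
cubeSum-*ˡ N c f = sumℚ-map-*ˡ c f (allCube N)

cubeSum-suc : ∀ N (g : Cube (suc N) → ℚ) →
  cubeSum (suc N) g ≡ cubeSum N (λ x → g (false ∷ x)) + cubeSum N (λ x → g (true ∷ x))
cubeSum-suc N g = begin
    sumℚ (map g (map (false ∷_) xs List.++ map (true ∷_) xs))
  ≡⟨ cong sumℚ (List.map-++ g (map (false ∷_) xs) (map (true ∷_) xs)) ⟩
    sumℚ (map g (map (false ∷_) xs) List.++ map g (map (true ∷_) xs))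
  ≡⟨ sumℚ-++ (map g (map (false ∷_) xs)) (map g (map (true ∷_) xs)) ⟩
    sumℚ (map g (map (false ∷_) xs)) + sumℚ (map g (map (true ∷_) xs))
  ≡⟨ cong₂ (λ ps qs → sumℚ ps + sumℚ qs) (sym (List.map-∘ xs)) (sym (List.map-∘ xs)) ⟩
    cubeSum N (λ x → g (false ∷ x)) + cubeSum N (λ x → g (true ∷ x))
  ∎
  where
  open ≡-Reasoning
  xs = allCube N

cubeSum-++ : ∀ N M (φ : Cube (N ℕ.+ M) → ℚ) → cubeSum (N ℕ.+ M) φ ≡ cubeSum N (λ x → cubeSum M (λ y → φ (x ++ y)))
cubeSum-++ zero    M φ = sym (+-identityʳ _)
cubeSum-++ (suc N) M φ = trans (cubeSum-suc (N ℕ.+ M) φ)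
  (trans (cong₂ _+_ (cubeSum-++ N M (λ z → φ (false ∷ z))) (cubeSum-++ N M (λ z → φ (true ∷ z))))
         (sym (cubeSum-suc N (λ x → cubeSum M (λ y → φ (x ++ y))))))

cubeSum-* : ∀ N M (f : Cube N → ℚ) (g : Cube M → ℚ) →
  cubeSum N f * cubeSum M g ≡ cubeSum N (λ x → cubeSum M (λ y → f x * g y))
cubeSum-* N M f g = begin
  cubeSum N f * cubeSum M g                        ≡⟨ *-comm (cubeSum N f) (cubeSum M g) ⟩
  cubeSum M g * cubeSum N f                        ≡⟨ sym (cubeSum-*ˡ N (cubeSum M g) f) ⟩
  cubeSum N (λ x → cubeSum M g * f x)              ≡⟨ cubeSum-cong N (λ x → *-comm (cubeSum M g) (f x)) ⟩
  cubeSum N (λ x → f x * cubeSum M g)              ≡⟨ cubeSum-cong N (λ x → sym (cubeSum-*ˡ M (f x) g)) ⟩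
  cubeSum N (λ x → cubeSum M (λ y → f x * g y))    ∎
  where open ≡-Reasoning

powℚ-+ : ∀ p m n → powℚ p (m ℕ.+ n) ≡ powℚ p m * powℚ p n
powℚ-+ p zero    n = sym (*-identityˡ _)
powℚ-+ p (suc m) n = trans (cong (p *_) (powℚ-+ p m n)) (sym (*-assoc p (powℚ p m) (powℚ p n)))

Expect-cong : ∀ N {f g : Cube N → ℚ} → (∀ x → f x ≡ g x) → Expect N f ≡ Expect N g
Expect-cong N f≗g = cong (powℚ half N *_) (cubeSum-cong N f≗g)

Expect-mono : ∀ N {f g : Cube N → ℚ} → (∀ x → f x ≤ g x) → Expect N f ≤ Expect N g
Expect-mono N f≤g = *-monoˡ-≤-0≤ (0≤powℚ N (*≤* (ℤ.+≤+ ℕ.z≤n))) (cubeSum-mono N f≤g)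

Expect-const : ∀ N c → Expect N (λ _ → c) ≡ c
Expect-const zero    c = trans (*-identityˡ _) (+-identityʳ c)
Expect-const (suc N) c = begin
    half * powℚ half N * cubeSum (suc N) (λ _ → c)
  ≡⟨ cong (half * powℚ half N *_) (cubeSum-suc N (λ _ → c)) ⟩
    half * powℚ half N * (cubeSum N (λ _ → c) + cubeSum N (λ _ → c))
  ≡⟨ halve (powℚ half N) (cubeSum N (λ _ → c)) ⟩
    Expect N (λ _ → c)
  ≡⟨ Expect-const N c ⟩
    c
  ∎
  where
  open ≡-Reasoning
  halve : ∀ p s → half * p * (s + s) ≡ p * s
  halve = solve 2 (λ p s → con half :* p :* (s :+ s) := p :* s) refl

Expect-++-* : ∀ N M (φ : Cube (N ℕ.+ M) → ℚ) (f : Cube N → ℚ) (g : Cube M → ℚ) →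
  (∀ x y → φ (x ++ y) ≡ f x * g y) → Expect (N ℕ.+ M) φ ≡ Expect N f * Expect M g
Expect-++-* N M φ f g φ-split = begin
    powℚ half (N ℕ.+ M) * cubeSum (N ℕ.+ M) φ
  ≡⟨ cong₂ _*_ (powℚ-+ half N M) (cubeSum-++ N M φ) ⟩
    hᴺ * hᴹ * cubeSum N (λ x → cubeSum M (λ y → φ (x ++ y)))
  ≡⟨ cong (hᴺ * hᴹ *_) (cubeSum-cong N (λ x → cubeSum-cong M (φ-split x))) ⟩
    hᴺ * hᴹ * cubeSum N (λ x → cubeSum M (λ y → f x * g y))
  ≡⟨ cong (hᴺ * hᴹ *_) (sym (cubeSum-* N M f g)) ⟩
    hᴺ * hᴹ * (cubeSum N f * cubeSum M g)
  ≡⟨ *-CS.interchange hᴺ hᴹ (cubeSum N f) (cubeSum M g) ⟩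
    hᴺ * cubeSum N f * (hᴹ * cubeSum M g)
  ∎
  where
  open ≡-Reasoning
  hᴺ = powℚ half N
  hᴹ = powℚ half M

sgn≤1 : ∀ b → sgn b ≤ 1ℚ
sgn≤1 false = ≤-refl
sgn≤1 true  = *≤* ℤ.-≤+

-1≤sgn : ∀ b → - 1ℚ ≤ sgn b
-1≤sgn false = *≤* ℤ.-≤+
-1≤sgn true  = ≤-refl

∣meanF∣≤1 : ∀ {N} (f : BFun N) → ∣ meanF f ∣ ≤ 1ℚ
∣meanF∣≤1 {N} f with ∣p∣≡p∨∣p∣≡-p (meanF f)
... | inj₁ ∣E∣≡E  = subst (_≤ 1ℚ) (sym ∣E∣≡E) (begin
  meanF f                  ≤⟨ Expect-mono N (λ x → sgn≤1 (f x)) ⟩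
  Expect N (λ _ → 1ℚ)      ≡⟨ Expect-const N 1ℚ ⟩
  1ℚ                       ∎)
  where open ≤-Reasoning
... | inj₂ ∣E∣≡-E = subst (_≤ 1ℚ) (sym ∣E∣≡-E) (neg-antimono-≤ (begin
  - 1ℚ                     ≡⟨ sym (Expect-const N (- 1ℚ)) ⟩
  Expect N (λ _ → - 1ℚ)    ≤⟨ Expect-mono N (λ x → -1≤sgn (f x)) ⟩
  meanF f                  ∎))
  where open ≤-Reasoning

sgn-xor : ∀ a b → sgn (a xor b) ≡ sgn a * sgn b
sgn-xor false false = refl
sgn-xor false true  = refl
sgn-xor true  false = refl
sgn-xor true  true  = refl

chi-++ : ∀ {N M} (S : Subset N) (T : Subset M) (x : Cube N) (y : Cube M) →
  chi (S ++ T) (x ++ y) ≡ chi S x * chi T y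
chi-++ []      T []      y = sym (*-identityˡ _)
chi-++ (s ∷ S) T (b ∷ x) y = trans (cong ((if s then sgn b else 1ℚ) *_) (chi-++ S T x y))
                                   (sym (*-assoc (if s then sgn b else 1ℚ) (chi S x) (chi T y)))

chi-∅ : ∀ {N} (x : Cube N) → chi ∅ x ≡ 1ℚ
chi-∅ []      = refl
chi-∅ (b ∷ x) = trans (*-identityˡ _) (chi-∅ x)

∅-++ : ∀ N M → ∅ {N ℕ.+ M} ≡ ∅ {N} ++ ∅ {M}
∅-++ zero    M = refl
∅-++ (suc N) M = cong (outside ∷_) (∅-++ N M)

card-++ : ∀ {N M} (S : Subset N) (T : Subset M) → card (S ++ T) ≡ card S ℕ.+ card T
card-++ []          T = refl
card-++ (false ∷ S) T = card-++ S T
card-++ (true ∷ S)  T = cong suc (card-++ S T)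

fourier-∅ : ∀ {N} (f : BFun N) → fourier f ∅ ≡ meanF f
fourier-∅ {N} f = Expect-cong N (λ x → trans (cong (sgn (f x) *_) (chi-∅ x)) (*-identityʳ _))

atLevel : ℕ → ℕ → ℚ → ℚ
atLevel k c a = if c ℕ.≡ᵇ k then a else 0ℚ

0≤atLevel : ∀ k c {a} → 0ℚ ≤ a → 0ℚ ≤ atLevel k c a
0≤atLevel k c 0≤a with c ℕ.≡ᵇ k
... | true  = 0≤a
... | false = ≤-refl

atLevel-*ʳ : ∀ k c a b → atLevel k c a * b ≡ atLevel k c (a * b)
atLevel-*ʳ k c a b with c ℕ.≡ᵇ k
... | true  = refl
... | false = *-zeroˡ b

atLevel-*ˡ : ∀ k c a b → a * atLevel k c b ≡ atLevel k c (a * b)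
atLevel-*ˡ k c a b with c ℕ.≡ᵇ k
... | true  = refl
... | false = *-zeroʳ a

-- k ≥ 1 keeps the two terms on the left from both being the coefficient at c = d = 0.
atLevel-split : ∀ k c d {a b} → 0ℚ ≤ a → 0ℚ ≤ b →
  atLevel (suc k) c a * atLevel 0 d b + atLevel 0 c a * atLevel (suc k) d b ≤ atLevel (suc k) (c ℕ.+ d) (a * b)
atLevel-split k zero    d       {a} {b} _   _   = ≤-reflexive
  (trans (cong (_+ a * atLevel (suc k) d b) (*-zeroˡ (atLevel 0 d b)))
         (trans (+-identityˡ _) (atLevel-*ˡ (suc k) d a b)))
atLevel-split k (suc c) zero    {a} {b} _   _   = ≤-reflexive
  (trans (+-identityʳ _) (trans (atLevel-*ʳ (suc k) (suc c) a b) (cong (λ n → atLevel (suc k) n (a * b)) (sym (ℕ.+-identityʳ (suc c))))))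
atLevel-split k (suc c) (suc d) {a} {b} 0≤a 0≤b = ≤-trans
  (≤-reflexive (trans (cong₂ _+_ (*-zeroʳ (atLevel (suc k) (suc c) a)) (*-zeroˡ (atLevel (suc k) (suc d) b))) (+-identityʳ 0ℚ)))
  (0≤atLevel (suc k) (suc c ℕ.+ suc d) (0≤* 0≤a 0≤b))

L1-cubeSum : ∀ {N} k (f : BFun N) → L1 k f ≡ cubeSum N (λ S → atLevel k (card S) ∣ fourier f S ∣)
L1-cubeSum {N} k f = sumℚ-map-filter (λ S → card S ℕ.≟ k) (λ S → ∣ fourier f S ∣) (allCube N)

0≤L1 : ∀ {N} k (f : BFun N) → 0ℚ ≤ L1 k f
0≤L1 {N} k f = begin
  0ℚ                                                  ≡⟨ sym (sumℚ-map-0 (allCube N)) ⟩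
  cubeSum N (λ _ → 0ℚ)                                ≤⟨ cubeSum-mono N (λ S → 0≤atLevel k (card S) (0≤∣p∣ (fourier f S))) ⟩
  cubeSum N (λ S → atLevel k (card S) ∣ fourier f S ∣) ≡⟨ sym (L1-cubeSum k f) ⟩
  L1 k f                                              ∎
  where open ≤-Reasoning

cubeSum-atLevel-0 : ∀ M (g : Subset M → ℚ) → cubeSum M (λ T → atLevel 0 (card T) (g T)) ≡ g ∅
cubeSum-atLevel-0 zero    g = +-identityʳ (g [])
cubeSum-atLevel-0 (suc M) g = trans (cubeSum-suc M (λ T → atLevel 0 (card T) (g T)))
  (trans (cong₂ _+_ (cubeSum-atLevel-0 M (λ T → g (false ∷ T))) (sumℚ-map-0 (allCube M))) (+-identityʳ _))

L1-zero : ∀ {N} (f : BFun N) → L1 0 f ≡ ∣ meanF f ∣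
L1-zero {N} f = trans (L1-cubeSum 0 f) (trans (cubeSum-atLevel-0 N (λ S → ∣ fourier f S ∣)) (cong ∣_∣ (fourier-∅ f)))

IsXor : ∀ {N M} → BFun N → BFun M → BFun (N ℕ.+ M) → Set
IsXor F G H = ∀ x y → H (x ++ y) ≡ F x xor G y

module _ {N M} (F : BFun N) (G : BFun M) (H : BFun (N ℕ.+ M)) (H-split : IsXor F G H) where

  fourier-xor : ∀ S T → fourier H (S ++ T) ≡ fourier F S * fourier G T
  fourier-xor S T = Expect-++-* N M _ _ _ (λ x y → begin
      sgn (H (x ++ y)) * chi (S ++ T) (x ++ y)
    ≡⟨ cong₂ _*_ (trans (cong sgn (H-split x y)) (sgn-xor (F x) (G y))) (chi-++ S T x y) ⟩
      sgn (F x) * sgn (G y) * (chi S x * chi T y)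
    ≡⟨ *-CS.interchange (sgn (F x)) (sgn (G y)) (chi S x) (chi T y) ⟩
      sgn (F x) * chi S x * (sgn (G y) * chi T y)
    ∎)
    where
    open ≡-Reasoning

  meanF-xor : meanF H ≡ meanF F * meanF G
  meanF-xor = begin
    meanF H                       ≡⟨ sym (fourier-∅ H) ⟩
    fourier H ∅                   ≡⟨ cong (fourier H) (∅-++ N M) ⟩
    fourier H (∅ {N} ++ ∅ {M})    ≡⟨ fourier-xor ∅ ∅ ⟩
    fourier F ∅ * fourier G ∅     ≡⟨ cong₂ _*_ (fourier-∅ F) (fourier-∅ G) ⟩
    meanF F * meanF G             ∎
    where open ≡-Reasoning

  L1-xor-superadditive : ∀ k → L1 (suc k) F * L1 0 G + L1 0 F * L1 (suc k) G ≤ L1 (suc k) H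
  L1-xor-superadditive k = begin
      L1 (suc k) F * L1 0 G + L1 0 F * L1 (suc k) G
    ≡⟨ cong₂ _+_ (cong₂ _*_ (L1-cubeSum (suc k) F) (L1-cubeSum 0 G)) (cong₂ _*_ (L1-cubeSum 0 F) (L1-cubeSum (suc k) G)) ⟩
      cubeSum N (a (suc k)) * cubeSum M (b 0) + cubeSum N (a 0) * cubeSum M (b (suc k))
    ≡⟨ cong₂ _+_ (cubeSum-* N M (a (suc k)) (b 0)) (cubeSum-* N M (a 0) (b (suc k))) ⟩
      cubeSum N (λ S → cubeSum M (λ T → a (suc k) S * b 0 T)) + cubeSum N (λ S → cubeSum M (λ T → a 0 S * b (suc k) T))
    ≡⟨ sym (trans (cubeSum-cong N (λ S → cubeSum-+ M _ _)) (cubeSum-+ N _ _)) ⟩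
      cubeSum N (λ S → cubeSum M (λ T → a (suc k) S * b 0 T + a 0 S * b (suc k) T))
    ≤⟨ cubeSum-mono N (λ S → cubeSum-mono M (λ T →
         atLevel-split k (card S) (card T) (0≤∣p∣ (fourier F S)) (0≤∣p∣ (fourier G T)))) ⟩
      cubeSum N (λ S → cubeSum M (λ T → atLevel (suc k) (card S ℕ.+ card T) (∣ fourier F S ∣ * ∣ fourier G T ∣)))
    ≡⟨ cubeSum-cong N (λ S → cubeSum-cong M (λ T → sym (cong₂ (atLevel (suc k)) (card-++ S T)
         (trans (cong ∣_∣ (fourier-xor S T)) (∣p*q∣≡∣p∣*∣q∣ (fourier F S) (fourier G T)))))) ⟩
      cubeSum N (λ S → cubeSum M (λ T → atLevel (suc k) (card (S ++ T)) ∣ fourier H (S ++ T) ∣))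
    ≡⟨ sym (trans (L1-cubeSum (suc k) H) (cubeSum-++ N M _)) ⟩
      L1 (suc k) H
    ∎
    where
    open ≤-Reasoning
    a : ℕ → Subset N → ℚ
    a j S = atLevel j (card S) ∣ fourier F S ∣
    b : ℕ → Subset M → ℚ
    b j T = atLevel j (card T) ∣ fourier G T ∣

xorCopies-suc : ∀ {N} t (f : BFun N) → IsXor f (xorCopies t f) (xorCopies (suc t) f)
xorCopies-suc {N} t f x y = cong₂ _xor_
  (cong f (trans (Vec.tabulate-cong (Vec.lookup-++ˡ x y)) (Vec.tabulate∘lookup x)))
  (cong (λ (v : Vec Bool t) → Vec.foldr (λ _ → Bool) _xor_ false v)
        (Vec.tabulate-cong (λ j → cong f (Vec.tabulate-cong (λ i → Vec.lookup-++ʳ x y (combine j i))))))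

module _ {N} (f : BFun N) where

  ∣meanF-xorCopies∣ : ∀ t → ∣ meanF (xorCopies t f) ∣ ≡ powℚ ∣ meanF f ∣ t
  ∣meanF-xorCopies∣ zero    = refl
  ∣meanF-xorCopies∣ (suc t) = begin
    ∣ meanF (xorCopies (suc t) f) ∣                ≡⟨ cong ∣_∣ (meanF-xor f (xorCopies t f) (xorCopies (suc t) f) (xorCopies-suc t f)) ⟩
    ∣ meanF f * meanF (xorCopies t f) ∣            ≡⟨ ∣p*q∣≡∣p∣*∣q∣ (meanF f) (meanF (xorCopies t f)) ⟩
    ∣ meanF f ∣ * ∣ meanF (xorCopies t f) ∣        ≡⟨ cong (∣ meanF f ∣ *_) (∣meanF-xorCopies∣ t) ⟩
    ∣ meanF f ∣ * powℚ ∣ meanF f ∣ t               ∎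
    where open ≡-Reasoning

  L1-xorCopies : ∀ k t → fromℕ (suc t) * powℚ ∣ meanF f ∣ t * L1 (suc k) f ≤ L1 (suc k) (xorCopies (suc t) f)
  L1-xorCopies k = recurrence-lower-bound (0≤∣p∣ (meanF f)) (0≤L1 (suc k) (xorCopies 0 f)) step
    where
    open ≤-Reasoning
    μ = ∣ meanF f ∣
    step : ∀ t → L1 (suc k) f * powℚ μ t + μ * L1 (suc k) (xorCopies t f) ≤ L1 (suc k) (xorCopies (suc t) f)
    step t = begin
        L1 (suc k) f * powℚ μ t + μ * L1 (suc k) (xorCopies t f)
      ≡⟨ sym (cong₂ (λ p q → L1 (suc k) f * p + q * L1 (suc k) (xorCopies t f))
                    (trans (L1-zero (xorCopies t f)) (∣meanF-xorCopies∣ t)) (L1-zero f)) ⟩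
        L1 (suc k) f * L1 0 (xorCopies t f) + L1 0 f * L1 (suc k) (xorCopies t f)
      ≤⟨ L1-xor-superadditive f (xorCopies t f) (xorCopies (suc t) f) (xorCopies-suc t f) k ⟩
        L1 (suc k) (xorCopies (suc t) f)
      ∎

lemmaA1 : (𝓕 : Class) → XorClosed 𝓕 → (k : ℕ) → 1 Data.Nat.≤ k → (b : ℚ) → 0ℚ < b
          → (∀ {N} (f : BFun N) → 𝓕 N f → L1 k f ≤ powℚ b k)
          → ∀ {N} (f : BFun N) → 𝓕 N f
          → ∀ (m : ℕ) → L1 k f ≤ (+ 2 / 1) * eUpper m * ((1ℚ - ∣ meanF f ∣) * half) * powℚ b k
lemmaA1 𝓕 closed (suc k) (ℕ.s≤s ℕ.z≤n) b _ bounded f f∈𝓕 m = begin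
    L1 (suc k) f
  ≤⟨ ≤eUpper*[1-μ]*B (0≤∣p∣ (meanF f)) (∣meanF∣≤1 f) (0≤L1 (suc k) f) growth m ⟩
    eUpper m * (1ℚ - μ) * powℚ b (suc k)
  ≡⟨ double-half (eUpper m) μ (powℚ b (suc k)) ⟩
    (+ 2 / 1) * eUpper m * ((1ℚ - μ) * half) * powℚ b (suc k)
  ∎
  where
  open ≤-Reasoning
  μ = ∣ meanF f ∣
  growth : ∀ t → fromℕ (suc t) * powℚ μ t * L1 (suc k) f ≤ powℚ b (suc k)
  growth t = ≤-trans (L1-xorCopies f k t) (bounded (xorCopies (suc t) f) (closed f f∈𝓕 (suc t) (ℕ.s≤s ℕ.z≤n)))
  double-half : ∀ e μ B → e * (1ℚ - μ) * B ≡ (+ 2 / 1) * e * ((1ℚ - μ) * half) * B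
  double-half = solve 3 (λ e μ B → e :* (con 1ℚ :- μ) :* B := con (+ 2 / 1) :* e :* ((con 1ℚ :- μ) :* con half) :* B) refl
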